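{- Let $g$ be a finite simple undirected graph, $k\ge1$ an integer, $S\subseteq V(g)$, $u\in V(g)\setminus S$, and let $lb$ be an integer with $|S|<lb<|V(g)|$. Put $R:=S\cup\{u\}$, $r:=lb-|S|$, and let $v_1,v_2,\dots,v_M$ ($M=|V(g)\setminus R|\ge r$) be an ordering of $V(g)\setminus R$ in non-decreasing order of $|\overline{N}_S(\cdot)|$ (ties broken arbitrarily). Let $C:=\{v_i\in V(g)\setminus R: |\overline{N}_S(v_i)|=|\overline{N}_S(v_r)|\}$, $C_1:=C\cap\{v_1,\dots,v_r\}$, $C_2:=C\setminus C_1$, and $D:=\{v_1,\dots,v_{r-|C_1|}\}$. Then $\mathrm{UB}(g,R)\le lb$ if and only if $$|\overline{E}(S)|+\sum_{j=1}^{r}|\overline{N}_S(v_j)|+|\overline{N}_{S\cup D}(u)|+\max\{|\overline{N}_{C_1}(u)|-|N_{C_2}(u)|,\,0\}>k.$$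
   Context: For a graph $g$ and $X\subseteq V(g)$, $\overline{E}(X)$ is the set of unordered pairs of distinct non-adjacent vertices of $X$; for a vertex $w$, $N_X(w)$ is the set of neighbors of $w$ in $X$ and $\overline{N}_X(w)$ is the set of vertices of $X\setminus\{w\}$ not adjacent to $w$. The degree-sequence-based upper bound of an instance $(g,R)$ with $R\subseteq V(g)$: let $w_1,\dots,w_M$ be the vertices of $V(g)\setminus R$ in non-decreasing order of $|\overline{N}_R(\cdot)|$; then $\mathrm{UB}(g,R):=|R|+\max\{i\in\{0,\dots,M\}: |\overline{E}(R)|+\sum_{j=1}^{i}|\overline{N}_R(w_j)|\le k\}$ (this value does not depend on tie-breaking), with the convention that the maximum of the empty set is $-\infty$. -}

module Defs where

open import Data.Bool using (Bool; true; false; not; _∧_; _∨_; if_then_else_)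
open import Data.Nat using (ℕ; zero; suc; _+_; _∸_; _≤_; _<ᵇ_; _≡ᵇ_)
open import Data.Nat.Properties using (≤-decTotalOrder)
open import Data.Fin using (Fin; toℕ; _≟_)
open import Data.Fin.Subset using (Subset; _∩_; ∣_∣)
open import Data.List using (List; []; _∷_; map; allFin; filter; take)
open import Data.Nat.ListAction using (sum)
open import Data.Bool.ListAction using (any)
open import Data.Maybe using (Maybe; just; nothing)
open import Data.Vec using (tabulate; lookup)
open import Relation.Nullary.Decidable using (⌊_⌋)
open import Relation.Binary.PropositionalEquality using (_≡_)
open import Data.List.Sort.MergeSort ≤-decTotalOrder using (mergeSort)
open import Data.List.Sort.Base using (SortingAlgorithm)
open import Data.Unit using (⊤)

record Graph (n : ℕ) : Set where
  field
    adj    : Fin n → Fin n → Bool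
    sym    : ∀ x y → adj x y ≡ adj y x
    irrefl : ∀ x → adj x x ≡ false
open Graph public

private
  _≟ᵇ_ : ∀ {n} → Fin n → Fin n → Bool
  x ≟ᵇ y = ⌊ x ≟ y ⌋

_∈ᵇ_ : ∀ {n} → Fin n → Subset n → Bool
x ∈ᵇ X = lookup X x

N : ∀ {n} → Graph n → Subset n → Fin n → Subset n
N g X w = X ∩ tabulate (λ x → adj g w x)

Nbar : ∀ {n} → Graph n → Subset n → Fin n → Subset n
Nbar g X w = X ∩ tabulate (λ x → not (adj g w x) ∧ not (x ≟ᵇ w))

-- |Ē(X)|: number of unordered pairs of distinct non-adjacent vertices of X
-- (each pair {x,y} counted once, as the ordered pair with toℕ x < toℕ y)
Ebar : ∀ {n} → Graph n → Subset n → ℕ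
Ebar {n} g X = sum (map f (allFin n))
  where
  f : Fin n → ℕ
  f x = if x ∈ᵇ X
        then ∣ X ∩ tabulate (λ y → (toℕ x <ᵇ toℕ y) ∧ not (adj g x y)) ∣
        else 0

sortℕ : List ℕ → List ℕ
sortℕ = SortingAlgorithm.sort mergeSort

prefixSum : ℕ → List ℕ → ℕ
prefixSum i xs = sum (take i xs)

-- max { i ∈ {0,…,M} : P i }, with nothing standing for −∞ (empty set)
maxUpTo : (ℕ → Bool) → ℕ → Maybe ℕ
maxUpTo P zero    = if P zero then just zero else nothing
maxUpTo P (suc m) = if P (suc m) then just (suc m) else maxUpTo P m

-- the degree-sequence-based upper bound UB(g,R); nothing = −∞
UB : ∀ {n} → ℕ → Graph n → Subset n → Maybe ℕ
UB {n} k g R = Data.Maybe.map (∣ R ∣ +_) (maxUpTo ok M)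
  where
  outside : List (Fin n)
  outside = filter (λ w → Data.Bool._≟_ (w ∈ᵇ R) false) (allFin n)
  ws : List ℕ
  ws = sortℕ (map (λ w → ∣ Nbar g R w ∣) outside)
  M : ℕ
  M = Data.List.length outside
  ok : ℕ → Bool
  ok i = (Ebar g R + prefixSum i ws) Data.Nat.≤ᵇ k

_≤∞_ : Maybe ℕ → ℕ → Set
nothing ≤∞ b = ⊤
just a  ≤∞ b = a ≤ b

-- {v_i : i ∈ Fin M, toℕ i < m}, i.e. {v_1,…,v_m} (1-based)
prefixSet : ∀ {n M} → (Fin M → Fin n) → ℕ → Subset n
prefixSet {n} {M} v m =
  tabulate (λ x → any (λ i → (toℕ i <ᵇ m) ∧ (v i ≟ᵇ x)) (allFin M))

prefixSumV : ∀ {n M} → (Fin M → Fin n) → (Fin n → ℕ) → ℕ → ℕ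
prefixSumV {n} {M} v f m =
  sum (map (λ i → if toℕ i <ᵇ m then f (v i) else 0) (allFin M))

sameKeySet : ∀ {n} → Graph n → Subset n → Subset n → ℕ → Subset n
sameKeySet g S R c =
  tabulate (λ x → not (x ∈ᵇ R) ∧ (∣ Nbar g S x ∣ ≡ᵇ c))

-- Adding u to S raises |Ē| by |N̄_S(u)|, and raises the cost |N̄_S(w)| of an
-- outside vertex w by one exactly when w is not adjacent to u. As prefix sums of a sorted list grow,
-- UB(g,R) ≤ lb = |R| + (r - 1) says exactly that |Ē(R)| plus the r smallest costs |N̄_R(w)| exceeds k.
-- Sorting by the key |N̄_S(v_i)|, with c the key of v_r, the costs in increasing order are: the
-- vertices of key below c (they form D and cost at most c), the vertices of key c adjacent to u
-- (cost c), those of key c not adjacent to u (cost c + 1), and the rest (cost at least c + 1); the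
-- sorted list is pinned down by uniqueness of sorted permutations. So the r = |D| + |C₁| smallest
-- costs sum to Σ_{j ≤ r} |N̄_S(v_j)| + |N̄_D(u)| + max(|C₁| - |N_C(u)|, 0), and
-- |C₁| - |N_C(u)| = |N̄_{C₁}(u)| - |N_{C₂}(u)|, truncated subtraction playing the role of max(·, 0).

module Submission where

open import Data.Bool using (Bool; true; false; not; _∧_; _∨_; if_then_else_; T)
import Data.Bool as Bool
open import Data.Bool.Properties using (T-≡; T-∧; T-not-≡; ∧-comm; ∧-identityʳ; ∧-zeroʳ; not-involutive)
open import Data.Empty using (⊥-elim)
open import Data.Fin using (Fin; toℕ; _≟_) renaming (zero to fzero; suc to fsuc)
open import Data.Fin.Properties using (toℕ-injective; toℕ<n)
open import Data.Fin.Subset using (Subset; ∣_∣; _∈_; _∉_; _∪_; _∩_; _─_; ⁅_⁆; Empty)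
open import Data.Fin.Subset.Properties using (x∈p∩q⁻; x∈⁅y⁆⇒x≡y; x∈⁅x⁆; x∈p∪q⁺; p∩q⊆p; p─q⊆p)
open import Data.List using (List; []; _∷_; _++_; map; allFin; filter; filterᵇ; length; replicate)
open import Data.List.Membership.Propositional using () renaming (_∈_ to _∈ˡ_)
open import Data.List.Membership.Propositional.Properties
  using (∈-allFin; ∈-filter⁻; ∈-filter⁺; ∈-map⁺; ∈-map⁻)
open import Data.List.Membership.Propositional.Properties.WithK using (unique∧set⇒bag)
open import Data.List.Properties
  using (map-cong; map-tabulate; filter-all; map-++; length-map; map-∘; length-tabulate)
open import Data.List.Relation.Binary.BagAndSetEquality using (∼bag⇒↭)
open import Data.List.Relation.Binary.Permutation.Propositional
  using (_↭_; ↭-refl; ↭-prep; ↭-trans; ↭-sym; ↭-reflexive; ↭⇒↭ₛ; module PermutationReasoning)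
import Data.List.Relation.Binary.Permutation.Propositional.Properties as ↭
open import Data.List.Relation.Binary.Pointwise using (Pointwise-≡⇒≡)
open import Data.List.Relation.Unary.All using (All)
import Data.List.Relation.Unary.All as All
import Data.List.Relation.Unary.All.Properties as All
open import Data.List.Relation.Unary.AllPairs using (AllPairs)
import Data.List.Relation.Unary.AllPairs.Properties as AllPairs
import Data.List.Relation.Unary.Any as Any
open import Data.List.Relation.Unary.Any.Properties using (any⁺; any⁻)
import Data.List.Relation.Unary.Unique.Propositional.Properties as Unique
open import Data.List.Relation.Unary.Sorted.TotalOrder.Properties
  using (↗↭↗⇒≋; AllPairs⇒Sorted; Sorted⇒AllPairs)
open import Data.List.Sort.Base using (SortingAlgorithm)
open import Data.Maybe using (Maybe; just; nothing)
import Data.Maybe as Maybe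
open import Data.Nat
  using (ℕ; zero; suc; _+_; _*_; _∸_; _≤_; _<_; _≥_; _<ᵇ_; _≤ᵇ_; _≡ᵇ_; z≤n; s≤s; _≤′_; ≤′-refl; ≤′-step)
open import Data.Nat.ListAction using (sum)
open import Data.Nat.ListAction.Properties using (sum-↭)
open import Data.Nat.Properties
  using ( ≤-decTotalOrder; ≤-totalOrder; +-commutativeSemigroup; module ≤-Reasoning
        ; ≤-refl; ≤-trans; ≤-<-trans; <⇒≤; <⇒≱; <⇒≢; <-irrefl; <-asym; <-cmp; n≮n; ≮⇒≥; ≰⇒>
        ; n≤1+n; m<1+n⇒m≤n
        ; m≤n⇒m<n∨m≡n; ≤⇒≤′; <ᵇ⇒<; <⇒<ᵇ; ≤ᵇ⇒≤; ≤⇒≤ᵇ; ≡ᵇ⇒≡; ≡⇒≡ᵇ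
        ; +-assoc; +-comm; +-suc; +-identityʳ; *-distribʳ-+; m≤m+n; +-monoʳ-≤; +-cancelˡ-≤
        ; [m+n]∸[m+o]≡n∸o; m+n∸m≡n; m+[n∸m]≡n )
open import Algebra.Properties.CommutativeSemigroup +-commutativeSemigroup using (interchange)
open import Data.List.Sort.MergeSort ≤-decTotalOrder using (mergeSort)
open import Data.Product using (_×_; _,_; proj₂; ∃-syntax)
open import Data.Sum using (inj₁; inj₂)
open import Data.Unit using (tt)
open import Data.Vec using ([]; _∷_; lookup) renaming (tabulate to tabulateᵛ)
open import Data.Vec.Base using (here; there)
open import Data.Vec.Properties
  using (lookup-replicate; lookup-zipWith; lookup∘tabulate; lookup⇒[]=; []=⇒lookup)
open import Defs hiding (sym)
open import Function using (_∘_; _⇔_; Equivalence; mk⇔; case_of_)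
open import Function.Definitions using (Injective)
open import Function.Properties.Equivalence using () renaming (trans to ⇔-trans)
open import Relation.Binary.Definitions using (tri<; tri≈; tri>)
open import Relation.Binary.PropositionalEquality
open import Relation.Nullary using (yes; no; ¬_; does)
open import Relation.Nullary.Decidable using (T?; ⌊_⌋; toWitness; fromWitness)
open import Relation.Unary using (Decidable)

T⇒≡ : ∀ {b} → T b → b ≡ true
T⇒≡ = Equivalence.to T-≡

≡⇒T : ∀ {b} → b ≡ true → T b
≡⇒T = Equivalence.from T-≡

¬T⇒≡ : ∀ {b} → ¬ T b → b ≡ false
¬T⇒≡ {false} _  = refl
¬T⇒≡ {true}  ¬t = ⊥-elim (¬t tt)

Bool-ext : ∀ {x y} → (T x → T y) → (T y → T x) → x ≡ y
Bool-ext {false} {false} _   _   = refl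
Bool-ext {false} {true}  _   y⇒x = ⊥-elim (y⇒x tt)
Bool-ext {true}  {false} x⇒y _   = ⊥-elim (x⇒y tt)
Bool-ext {true}  {true}  _   _   = refl

𝟙 : Bool → ℕ
𝟙 b = if b then 1 else 0

𝟙≤1 : ∀ x → 𝟙 x ≤ 1
𝟙≤1 true  = ≤-refl
𝟙≤1 false = z≤n

𝟙-split : ∀ x y → 𝟙 x ≡ 𝟙 (x ∧ not y) + 𝟙 (x ∧ y)
𝟙-split true  true  = refl
𝟙-split true  false = refl
𝟙-split false _     = refl

∧-swapʳ : ∀ x y z → (x ∧ y) ∧ z ≡ (x ∧ z) ∧ y
∧-swapʳ true  y z = ∧-comm y z
∧-swapʳ false y z = refl

<ᵇ-true : ∀ {m n} → m < n → (m <ᵇ n) ≡ true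
<ᵇ-true = T⇒≡ ∘ <⇒<ᵇ

<ᵇ-false : ∀ {m n} → ¬ m < n → (m <ᵇ n) ≡ false
<ᵇ-false {m} {n} m≮n = ¬T⇒≡ (m≮n ∘ <ᵇ⇒< m n)

≡ᵇ-true : ∀ {m n} → m ≡ n → (m ≡ᵇ n) ≡ true
≡ᵇ-true {m} {n} = T⇒≡ ∘ ≡⇒≡ᵇ m n

≡ᵇ-false : ∀ {m n} → m ≢ n → (m ≡ᵇ n) ≡ false
≡ᵇ-false {m} {n} m≢n = ¬T⇒≡ (m≢n ∘ ≡ᵇ⇒≡ m n)

𝟙-not-<ᵇ : ∀ x c → 𝟙 (not (x <ᵇ c)) ≡ 𝟙 (x ≡ᵇ c) + 𝟙 (c <ᵇ x)
𝟙-not-<ᵇ zero    zero    = refl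
𝟙-not-<ᵇ zero    (suc c) = refl
𝟙-not-<ᵇ (suc x) zero    = refl
𝟙-not-<ᵇ (suc x) (suc c) = 𝟙-not-<ᵇ x c

module _ {A : Set} where

  sum-map-+ : (f g : A → ℕ) (xs : List A) →
              sum (map (λ x → f x + g x) xs) ≡ sum (map f xs) + sum (map g xs)
  sum-map-+ f g []       = refl
  sum-map-+ f g (x ∷ xs) = trans (cong (f x + g x +_) (sum-map-+ f g xs))
                                 (interchange (f x) (g x) (sum (map f xs)) (sum (map g xs)))

  sum-map-*ʳ : (f : A → ℕ) (c : ℕ) (xs : List A) →
               sum (map (λ x → f x * c) xs) ≡ sum (map f xs) * c
  sum-map-*ʳ f c []       = refl
  sum-map-*ʳ f c (x ∷ xs) = trans (cong (f x * c +_) (sum-map-*ʳ f c xs))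
                                  (sym (*-distribʳ-+ c (f x) (sum (map f xs))))

  sum-map-filter : {P : A → Set} (P? : Decidable P) (f : A → ℕ) (xs : List A) →
    sum (map f (filter P? xs)) ≡ sum (map (λ x → if does (P? x) then f x else 0) xs)
  sum-map-filter P? f []       = refl
  sum-map-filter P? f (x ∷ xs) with does (P? x)
  ... | true  = cong (f x +_) (sum-map-filter P? f xs)
  ... | false = sum-map-filter P? f xs

  length-filter-sum : {P : A → Set} (P? : Decidable P) (xs : List A) →
    length (filter P? xs) ≡ sum (map (𝟙 ∘ does ∘ P?) xs)
  length-filter-sum P? []       = refl
  length-filter-sum P? (x ∷ xs) with does (P? x)
  ... | true  = cong suc (length-filter-sum P? xs)
  ... | false = length-filter-sum P? xs

  map-filterᵇ-const : {B : Set} (p : A → Bool) {f : A → B} {c : B} → (∀ x → T (p x) → f x ≡ c) →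
    (xs : List A) → map f (filterᵇ p xs) ≡ replicate (length (filterᵇ p xs)) c
  map-filterᵇ-const p f≡c []       = refl
  map-filterᵇ-const p f≡c (x ∷ xs) with p x in px
  ... | true  = cong₂ _∷_ (f≡c x (≡⇒T px)) (map-filterᵇ-const p f≡c xs)
  ... | false = map-filterᵇ-const p f≡c xs

  All-map-filterᵇ : {B : Set} (p : A → Bool) {f : A → B} {P : B → Set} → (∀ x → T (p x) → P (f x)) →
    (xs : List A) → All P (map f (filterᵇ p xs))
  All-map-filterᵇ p P∘f xs = All.map⁺ (All.map (P∘f _) (All.all-filter (T? ∘ p) xs))

  filterᵇ-↭-split : (p q r : A → Bool) →
    (∀ x → 𝟙 (p x) ≡ 𝟙 (q x) + 𝟙 (r x)) →
    (xs : List A) → filterᵇ p xs ↭ filterᵇ q xs ++ filterᵇ r xs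
  filterᵇ-↭-split p q r split []       = ↭-refl
  filterᵇ-↭-split p q r split (x ∷ xs) with p x | q x | r x | split x
  ... | true  | true  | false | _ = ↭-prep x (filterᵇ-↭-split p q r split xs)
  ... | true  | false | true  | _ = ↭-trans (↭-prep x (filterᵇ-↭-split p q r split xs))
                                            (↭-sym (↭.shift x (filterᵇ q xs) (filterᵇ r xs)))
  ... | false | false | false | _ = filterᵇ-↭-split p q r split xs
  ... | true  | true  | true  | ()
  ... | true  | false | false | ()
  ... | false | true  | _     | ()
  ... | false | false | true  | ()

∑ : ∀ {m} → (Fin m → ℕ) → ℕ
∑ {m} f = sum (map f (allFin m))

sumOver : ∀ {m} → (Fin m → Bool) → (Fin m → ℕ) → ℕ
sumOver p f = ∑ (λ x → if p x then f x else 0)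

count : ∀ {m} → (Fin m → Bool) → ℕ
count p = sumOver p (λ _ → 1)

module _ {m : ℕ} where

  ∑-cong : {f g : Fin m → ℕ} → (∀ x → f x ≡ g x) → ∑ f ≡ ∑ g
  ∑-cong f≗g = cong sum (map-cong f≗g (allFin m))

  ∑-+ : (f g : Fin m → ℕ) → ∑ (λ x → f x + g x) ≡ ∑ f + ∑ g
  ∑-+ f g = sum-map-+ f g (allFin m)

  sumOver-congˡ : ∀ {p q : Fin m → Bool} {f} → (∀ x → p x ≡ q x) → sumOver p f ≡ sumOver q f
  sumOver-congˡ {f = f} p≗q = ∑-cong (λ x → cong (if_then f x else 0) (p≗q x))

  sumOver-congʳ : ∀ (p : Fin m → Bool) {f g : Fin m → ℕ} → (∀ x → T (p x) → f x ≡ g x) →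
                  sumOver p f ≡ sumOver p g
  sumOver-congʳ p {f} {g} f≗g = ∑-cong on-support
    where
    on-support : ∀ x → (if p x then f x else 0) ≡ (if p x then g x else 0)
    on-support x with p x in px
    ... | true  = f≗g x (≡⇒T px)
    ... | false = refl

  sumOver-+ : ∀ (p : Fin m → Bool) f g → sumOver p (λ x → f x + g x) ≡ sumOver p f + sumOver p g
  sumOver-+ p f g = trans (∑-cong split) (∑-+ _ _)
    where
    split : ∀ x → (if p x then f x + g x else 0) ≡ (if p x then f x else 0) + (if p x then g x else 0)
    split x with p x
    ... | true  = refl
    ... | false = refl

  sumOver-split : (p q : Fin m → Bool) (f : Fin m → ℕ) →
                  sumOver p f ≡ sumOver (λ x → p x ∧ q x) f + sumOver (λ x → p x ∧ not (q x)) f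
  sumOver-split p q f = trans (∑-cong split) (∑-+ _ _)
    where
    split : ∀ x → (if p x then f x else 0) ≡
                  (if p x ∧ q x then f x else 0) + (if p x ∧ not (q x) then f x else 0)
    split x with p x | q x
    ... | false | _     = refl
    ... | true  | true  = sym (+-identityʳ (f x))
    ... | true  | false = refl

  sumOver-const : (p : Fin m → Bool) (c : ℕ) → sumOver p (λ _ → c) ≡ count p * c
  sumOver-const p c = trans (∑-cong pointwise) (sum-map-*ʳ (𝟙 ∘ p) c (allFin m))
    where
    pointwise : ∀ x → (if p x then c else 0) ≡ 𝟙 (p x) * c
    pointwise x with p x
    ... | true  = sym (+-identityʳ c)
    ... | false = refl

∑-suc : ∀ {m} (f : Fin (suc m) → ℕ) → ∑ f ≡ f fzero + ∑ (f ∘ fsuc)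
∑-suc {m} f = cong (λ xs → f fzero + sum xs)
  (trans (map-tabulate fsuc f) (sym (map-tabulate (λ x → x) (f ∘ fsuc))))

sumOver-suc : ∀ {m} (p : Fin (suc m) → Bool) (f : Fin (suc m) → ℕ) →
              sumOver p f ≡ (if p fzero then f fzero else 0) + sumOver (p ∘ fsuc) (f ∘ fsuc)
sumOver-suc p f = ∑-suc (λ i → if p i then f i else 0)

sumOver-none : ∀ {m} (p : Fin m → Bool) f → (∀ i → p i ≡ false) → sumOver p f ≡ 0
sumOver-none {zero}  p f none = refl
sumOver-none {suc m} p f none rewrite sumOver-suc p f | none fzero =
  sumOver-none (p ∘ fsuc) (f ∘ fsuc) (none ∘ fsuc)

count-suc : ∀ {m} (p : Fin (suc m) → Bool) →
            count p ≡ 𝟙 (p fzero) + count (p ∘ fsuc)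
count-suc p = sumOver-suc p (λ _ → 1)

count-<ᵇ : ∀ {m} q → q ≤ m → count {m} (λ i → toℕ i <ᵇ q) ≡ q
count-<ᵇ {zero}  zero    _         = refl
count-<ᵇ {suc m} zero    _         =
  trans (count-suc {m} (λ i → toℕ i <ᵇ 0)) (count-<ᵇ {m} zero z≤n)
count-<ᵇ {suc m} (suc q) (s≤s q≤m) =
  trans (count-suc {m} (λ i → toℕ i <ᵇ suc q)) (cong suc (count-<ᵇ q q≤m))

DownClosed : ∀ {m} → (Fin m → Bool) → Set
DownClosed p = ∀ {i j} → toℕ j ≤ toℕ i → T (p i) → T (p j)

downClosed⇒initialSegment : ∀ {m} (p : Fin m → Bool) → DownClosed p →
                            ∀ i → p i ≡ (toℕ i <ᵇ count p)
downClosed⇒initialSegment {suc m} p closed i with T? (p fzero)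
... | yes p₀ = trans (shifted i) (cong (toℕ i <ᵇ_) (sym count≡))
  where
  count≡ : count p ≡ suc (count (p ∘ fsuc))
  count≡ = trans (count-suc p) (cong (λ b → 𝟙 b + count (p ∘ fsuc)) (T⇒≡ p₀))
  shifted : ∀ i → p i ≡ (toℕ i <ᵇ suc (count (p ∘ fsuc)))
  shifted fzero    = T⇒≡ p₀
  shifted (fsuc i) = downClosed⇒initialSegment (p ∘ fsuc) (λ j≤i → closed (s≤s j≤i)) i
... | no ¬p₀ = trans (none i) (cong (toℕ i <ᵇ_) (sym (sumOver-none p _ none)))
  where
  none : ∀ i → p i ≡ false
  none i = ¬T⇒≡ (¬p₀ ∘ closed z≤n)

count-∧ : ∀ {m} (p q : Fin m → Bool) → count (λ x → p x ∧ q x) ≡ sumOver p (𝟙 ∘ q)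
count-∧ p q = ∑-cong λ x → 𝟙-∧ (p x)
  where
  𝟙-∧ : ∀ a {b} → 𝟙 (a ∧ b) ≡ (if a then 𝟙 b else 0)
  𝟙-∧ true  = refl
  𝟙-∧ false = refl

-- Sorting and prefix sums

Separated : List ℕ → List ℕ → Set
Separated ys zs = All (λ y → All (y ≤_) zs) ys

separated-by : ∀ c {ys zs} → All (_≤ c) ys → All (c ≤_) zs → Separated ys zs
separated-by c ys≤c c≤zs = All.map (λ y≤c → All.map (≤-trans y≤c) c≤zs) ys≤c

module _ where

  open SortingAlgorithm mergeSort using (sort-↭; sort-↗)

  sortℕ-sorted : ∀ xs → AllPairs _≤_ (sortℕ xs)
  sortℕ-sorted xs = Sorted⇒AllPairs ≤-totalOrder (sort-↗ xs)

  sortℕ-unique : ∀ {xs ys} → AllPairs _≤_ ys → xs ↭ ys → sortℕ xs ≡ ys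
  sortℕ-unique {xs} ys↗ xs↭ys = Pointwise-≡⇒≡ (↗↭↗⇒≋ ≤-totalOrder (sort-↗ xs)
    (AllPairs⇒Sorted ≤-totalOrder ys↗) (↭⇒↭ₛ (↭-trans (sort-↭ xs) xs↭ys)))

  sortℕ-↭ : ∀ {xs ys} → xs ↭ ys → sortℕ xs ≡ sortℕ ys
  sortℕ-↭ {ys = ys} xs↭ys = sortℕ-unique (sortℕ-sorted ys) (↭-trans xs↭ys (↭-sym (sort-↭ ys)))

  sortℕ-++ : ∀ {ys zs} → Separated ys zs → sortℕ (ys ++ zs) ≡ sortℕ ys ++ sortℕ zs
  sortℕ-++ {ys} {zs} ys≤zs = sortℕ-unique
    (AllPairs.++⁺ (sortℕ-sorted ys) (sortℕ-sorted zs)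
      (↭.All-resp-↭ (↭-sym (sort-↭ ys)) (All.map (↭.All-resp-↭ (↭-sym (sort-↭ zs))) ys≤zs)))
    (↭.++⁺ (↭-sym (sort-↭ ys)) (↭-sym (sort-↭ zs)))

  sortℕ-replicate : ∀ n c → sortℕ (replicate n c) ≡ replicate n c
  sortℕ-replicate n c = sortℕ-unique (replicate-sorted n) ↭-refl
    where
    replicate-sorted : ∀ n → AllPairs _≤_ (replicate n c)
    replicate-sorted zero    = AllPairs.[]
    replicate-sorted (suc n) = All.replicate⁺ n ≤-refl AllPairs.∷ replicate-sorted n

  length-sortℕ : ∀ xs → length (sortℕ xs) ≡ length xs
  length-sortℕ xs = ↭.↭-length (sort-↭ xs)

  sum-sortℕ : ∀ xs → sum (sortℕ xs) ≡ sum xs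
  sum-sortℕ xs = sum-↭ (sort-↭ xs)

prefixSum-++ : ∀ xs ys m → prefixSum (length xs + m) (xs ++ ys) ≡ sum xs + prefixSum m ys
prefixSum-++ []       ys m = refl
prefixSum-++ (x ∷ xs) ys m =
  trans (cong (x +_) (prefixSum-++ xs ys m)) (sym (+-assoc x (sum xs) (prefixSum m ys)))

prefixSum-≤-suc : ∀ i xs → prefixSum i xs ≤ prefixSum (suc i) xs
prefixSum-≤-suc zero    xs       = z≤n
prefixSum-≤-suc (suc i) []       = ≤-refl
prefixSum-≤-suc (suc i) (x ∷ xs) = +-monoʳ-≤ x (prefixSum-≤-suc i xs)

prefixSum-replicate-suc : ∀ c m q rest → m ≤ q →
  prefixSum m (replicate q (suc c) ++ rest) ≡ m * c + m
prefixSum-replicate-suc c zero    q       rest _         = refl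
prefixSum-replicate-suc c (suc m) (suc q) rest (s≤s m≤q) = begin
  suc c + prefixSum m (replicate q (suc c) ++ rest)  ≡⟨ cong (suc c +_) (prefixSum-replicate-suc c m q rest m≤q) ⟩
  suc (c + (m * c + m))                              ≡⟨ cong suc (+-assoc c (m * c) m) ⟨
  suc (c + m * c + m)                                ≡⟨ +-suc (c + m * c) m ⟨
  c + m * c + suc m                                  ∎
  where open ≡-Reasoning

prefixSum-ties : ∀ c m p q rest → m ≤ p + q →
  prefixSum m ((replicate p c ++ replicate q (suc c)) ++ rest) ≡ m * c + (m ∸ p)
prefixSum-ties c m       zero    q rest m≤q         = prefixSum-replicate-suc c m q rest m≤q
prefixSum-ties c zero    (suc p) q rest _           = refl
prefixSum-ties c (suc m) (suc p) q rest (s≤s m≤p+q) =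
  trans (cong (c +_) (prefixSum-ties c m p q rest m≤p+q)) (sym (+-assoc c (m * c) (m ∸ p)))

-- The bound UB as a threshold on a prefix sum

Antitone : (ℕ → Bool) → Set
Antitone P = ∀ i → T (P (suc i)) → T (P i)

antitone-≤ : ∀ {P} → Antitone P → ∀ {i j} → i ≤ j → T (P j) → T (P i)
antitone-≤ {P} anti i≤j = go (≤⇒≤′ i≤j)
  where
  go : ∀ {i j} → i ≤′ j → T (P j) → T (P i)
  go ≤′-refl        = λ Pj → Pj
  go (≤′-step i≤′j) = go i≤′j ∘ anti _

≤∞-step : ∀ (m : Maybe ℕ) {b} → m ≤∞ b → m ≤∞ suc b
≤∞-step nothing  _   = tt
≤∞-step (just a) a≤b = ≤-trans a≤b (n≤1+n _)

maxUpTo-≤∞-bound : ∀ P K → maxUpTo P K ≤∞ K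
maxUpTo-≤∞-bound P zero with P zero
... | true  = z≤n
... | false = tt
maxUpTo-≤∞-bound P (suc K) with P (suc K)
... | true  = ≤-refl
... | false = ≤∞-step (maxUpTo P K) (maxUpTo-≤∞-bound P K)

maxUpTo-≤∞-⇔ : ∀ P → Antitone P → ∀ {j} K → j < K → maxUpTo P K ≤∞ j ⇔ (¬ T (P (suc j)))
maxUpTo-≤∞-⇔ P anti {j} (suc K) (s≤s j≤K) with P (suc K) in P[1+K]
... | true  = mk⇔ (λ K<j → ⊥-elim (<⇒≱ K<j j≤K))
                  (λ ¬P[1+j] → ⊥-elim (¬P[1+j] (antitone-≤ anti (s≤s j≤K) (≡⇒T P[1+K]))))
... | false with m≤n⇒m<n∨m≡n j≤K
...   | inj₁ j<K  = maxUpTo-≤∞-⇔ P anti K j<K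
...   | inj₂ refl = mk⇔ (λ _ → subst T P[1+K]) (λ _ → maxUpTo-≤∞-bound P K)

map-+-≤∞-⇔ : ∀ a (m : Maybe ℕ) b → Maybe.map (a +_) m ≤∞ (a + b) ⇔ m ≤∞ b
map-+-≤∞-⇔ a nothing  b = mk⇔ (λ _ → tt) (λ _ → tt)
map-+-≤∞-⇔ a (just i) b = mk⇔ (+-cancelˡ-≤ a i b) (+-monoʳ-≤ a)

¬≤ᵇ-⇔ : ∀ x k → (¬ T (x ≤ᵇ k)) ⇔ k < x
¬≤ᵇ-⇔ x k = mk⇔ (λ ¬x≤k → ≰⇒> (¬x≤k ∘ ≤⇒≤ᵇ)) (λ k<x → <⇒≱ k<x ∘ ≤ᵇ⇒≤ x k)

-- Definitionally the list of outside vertices used inside UB.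
outside : ∀ {n} → Subset n → List (Fin n)
outside {n} R = filter (λ w → lookup R w Bool.≟ false) (allFin n)

sortedNonDegrees : ∀ {n} → Graph n → Subset n → List ℕ
sortedNonDegrees g R = sortℕ (map (λ w → ∣ Nbar g R w ∣) (outside R))

UB-≤∞-⇔ : ∀ {n} k (g : Graph n) (R : Subset n) {j} → j < length (outside R) →
          UB k g R ≤∞ (∣ R ∣ + j) ⇔ k < Ebar g R + prefixSum (suc j) (sortedNonDegrees g R)
UB-≤∞-⇔ k g R {j} j<M =
  ⇔-trans (map-+-≤∞-⇔ ∣ R ∣ (maxUpTo fits (length (outside R))) j)
  (⇔-trans (maxUpTo-≤∞-⇔ fits fits-antitone _ j<M)
           (¬≤ᵇ-⇔ (Ebar g R + prefixSum (suc j) (sortedNonDegrees g R)) k))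
  where
  fits : ℕ → Bool
  fits i = (Ebar g R + prefixSum i (sortedNonDegrees g R)) ≤ᵇ k
  fits-antitone : Antitone fits
  fits-antitone i fits[1+i] = ≤⇒≤ᵇ (≤-trans (+-monoʳ-≤ (Ebar g R) (prefixSum-≤-suc i _))
                                             (≤ᵇ⇒≤ _ k fits[1+i]))

-- The r cheapest costs a i + 𝟙 (b i) over sorted keys a

module TieBlock {M : ℕ} (a : Fin M → ℕ) (a-mono : ∀ i j → toℕ i ≤ toℕ j → a i ≤ a j)
                (j : Fin M) (b : Fin M → Bool) where

  c r : ℕ
  c = a j
  r = suc (toℕ j)

  below tied above early tied₀ tied₁ : Fin M → Bool
  below i = a i <ᵇ c
  tied  i = a i ≡ᵇ c
  above i = c <ᵇ a i
  early i = toℕ i <ᵇ r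
  tied₀ i = tied i ∧ not (b i)
  tied₁ i = tied i ∧ b i

  F : Fin M → ℕ
  F i = a i + 𝟙 (b i)

  below⇒early : ∀ i → T (below i) → T (early i)
  below⇒early i a<c = <⇒<ᵇ (s≤s (≮⇒≥ λ j<i → <⇒≱ (<ᵇ⇒< (a i) c a<c) (a-mono j i (<⇒≤ j<i))))

  early⇒≤ : ∀ i → T (early i) → a i ≤ c
  early⇒≤ i i<r = a-mono i j (m<1+n⇒m≤n (<ᵇ⇒< (toℕ i) r i<r))

  tied⇒≡ : ∀ {i} → T (tied i) → a i ≡ c
  tied⇒≡ {i} = ≡ᵇ⇒≡ (a i) c

  early∧untied≡below : ∀ i → early i ∧ not (tied i) ≡ below i
  early∧untied≡below i with <-cmp (a i) c
  ... | tri< a<c _ _ rewrite <ᵇ-true a<c | ≡ᵇ-false (<⇒≢ a<c) | T⇒≡ (below⇒early i (<⇒<ᵇ a<c)) = refl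
  ... | tri≈ _ a≡c _ rewrite ≡ᵇ-true a≡c | <ᵇ-false (<-irrefl a≡c) = ∧-zeroʳ (early i)
  ... | tri> _ _ c<a rewrite <ᵇ-false (<-asym c<a) | ¬T⇒≡ (<⇒≱ c<a ∘ early⇒≤ i) = refl

  early∧tied≡tied∧early : ∀ i → early i ∧ tied i ≡ tied i ∧ early i
  early∧tied≡tied∧early i = ∧-comm (early i) (tied i)

  nBelow nTiedEarly nTied₀ nTied₁ : ℕ
  nBelow     = count below
  nTiedEarly = count (λ i → tied i ∧ early i)
  nTied₀     = count tied₀
  nTied₁     = count tied₁

  r≡nTiedEarly+nBelow : r ≡ nTiedEarly + nBelow
  r≡nTiedEarly+nBelow = begin
    r                                   ≡⟨ count-<ᵇ r (toℕ<n j) ⟨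
    count early                         ≡⟨ sumOver-split early tied (λ _ → 1) ⟩
    count (λ i → early i ∧ tied i) + count (λ i → early i ∧ not (tied i))
      ≡⟨ cong₂ _+_ (sumOver-congˡ early∧tied≡tied∧early) (sumOver-congˡ early∧untied≡below) ⟩
    nTiedEarly + nBelow                 ∎
    where open ≡-Reasoning

  below≡prefix : ∀ i → below i ≡ (toℕ i <ᵇ r ∸ nTiedEarly)
  below≡prefix i = begin
    below i                             ≡⟨ downClosed⇒initialSegment below below-closed i ⟩
    toℕ i <ᵇ nBelow                     ≡⟨ cong (toℕ i <ᵇ_) (m+n∸m≡n nTiedEarly nBelow) ⟨
    toℕ i <ᵇ nTiedEarly + nBelow ∸ nTiedEarly
                                        ≡⟨ cong (λ m → toℕ i <ᵇ m ∸ nTiedEarly) r≡nTiedEarly+nBelow ⟨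
    toℕ i <ᵇ r ∸ nTiedEarly             ∎
    where
    open ≡-Reasoning
    below-closed : DownClosed below
    below-closed {i} {k} k≤i k<c = <⇒<ᵇ (≤-<-trans (a-mono k i k≤i) (<ᵇ⇒< (a i) c k<c))

  sumOver-early : sumOver early a ≡ sumOver below a + nTiedEarly * c
  sumOver-early = begin
    sumOver early a
      ≡⟨ sumOver-split early tied a ⟩
    sumOver (λ i → early i ∧ tied i) a + sumOver (λ i → early i ∧ not (tied i)) a
      ≡⟨ cong₂ _+_ (sumOver-congʳ (λ i → early i ∧ tied i) tied⇒c) (sumOver-congˡ early∧untied≡below) ⟩
    sumOver (λ i → early i ∧ tied i) (λ _ → c) + sumOver below a
      ≡⟨ cong (_+ sumOver below a) (sumOver-const (λ i → early i ∧ tied i) c) ⟩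
    count (λ i → early i ∧ tied i) * c + sumOver below a
      ≡⟨ cong (λ m → m * c + sumOver below a) (sumOver-congˡ early∧tied≡tied∧early) ⟩
    nTiedEarly * c + sumOver below a
      ≡⟨ +-comm (nTiedEarly * c) _ ⟩
    sumOver below a + nTiedEarly * c    ∎
    where
    open ≡-Reasoning
    tied⇒c : ∀ i → T (early i ∧ tied i) → a i ≡ c
    tied⇒c i = tied⇒≡ ∘ proj₂ ∘ Equivalence.to (T-∧ {early i})

  nTiedEarly≤nTied₀+nTied₁ : nTiedEarly ≤ nTied₀ + nTied₁
  nTiedEarly≤nTied₀+nTied₁ = begin
    nTiedEarly                                          ≤⟨ m≤m+n _ _ ⟩
    nTiedEarly + count (λ i → tied i ∧ not (early i))   ≡⟨ sumOver-split tied early (λ _ → 1) ⟨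
    count tied                                          ≡⟨ sumOver-split tied b (λ _ → 1) ⟩
    nTied₁ + nTied₀                                     ≡⟨ +-comm nTied₁ nTied₀ ⟩
    nTied₀ + nTied₁                                     ∎
    where open ≤-Reasoning

  nTiedEarly∸nTied₀ : nTiedEarly ∸ nTied₀ ≡
                      count (λ i → (tied i ∧ early i) ∧ b i) ∸ count (λ i → tied₀ i ∧ not (early i))
  nTiedEarly∸nTied₀ = begin
    nTiedEarly ∸ nTied₀
      ≡⟨ cong₂ _∸_ (sumOver-split (λ i → tied i ∧ early i) b (λ _ → 1))
                   (sumOver-split tied₀ early (λ _ → 1)) ⟩
    (X + count (λ i → (tied i ∧ early i) ∧ not (b i))) ∸ (Y + Z)
      ≡⟨ cong (λ W → (X + W) ∸ (Y + Z)) (sumOver-congˡ (λ i → ∧-swapʳ (tied i) (early i) (not (b i)))) ⟩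
    (X + Y) ∸ (Y + Z)                   ≡⟨ cong (_∸ (Y + Z)) (+-comm X Y) ⟩
    (Y + X) ∸ (Y + Z)                   ≡⟨ [m+n]∸[m+o]≡n∸o Y X Z ⟩
    X ∸ Z                               ∎
    where
    open ≡-Reasoning
    X Y Z : ℕ
    X = count (λ i → (tied i ∧ early i) ∧ b i)
    Y = count (λ i → tied₀ i ∧ early i)
    Z = count (λ i → tied₀ i ∧ not (early i))

  indices : (Fin M → Bool) → List (Fin M)
  indices p = filterᵇ p (allFin M)

  length-indices : ∀ p → length (indices p) ≡ count p
  length-indices p = length-filter-sum (T? ∘ p) (allFin M)

  allFin-↭ : allFin M ↭ indices below ++ ((indices tied₀ ++ indices tied₁) ++ indices above)
  allFin-↭ = begin
    allFin M
      ≡⟨ filter-all (T? ∘ λ _ → true) (All.universal _ (allFin M)) ⟨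
    indices (λ _ → true)
      ↭⟨ filterᵇ-↭-split _ below (not ∘ below)
           (λ i → trans (𝟙-split true (below i)) (+-comm (𝟙 (not (below i))) _)) (allFin M) ⟩
    indices below ++ indices (not ∘ below)
      ↭⟨ ↭.++⁺ˡ (indices below) (filterᵇ-↭-split _ tied above (λ i → 𝟙-not-<ᵇ (a i) c) (allFin M)) ⟩
    indices below ++ (indices tied ++ indices above)
      ↭⟨ ↭.++⁺ˡ (indices below) (↭.++⁺ʳ (indices above)
           (filterᵇ-↭-split tied tied₀ tied₁ (λ i → 𝟙-split (tied i) (b i)) (allFin M))) ⟩
    indices below ++ ((indices tied₀ ++ indices tied₁) ++ indices above) ∎
    where open PermutationReasoning

  F-below : ∀ i → T (below i) → F i ≤ c
  F-below i a<c = ≤-trans (+-monoʳ-≤ (a i) (𝟙≤1 (b i)))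
                          (subst (_≤ c) (+-comm 1 (a i)) (<ᵇ⇒< (a i) c a<c))

  F-tied₀ : ∀ i → T (tied₀ i) → F i ≡ c
  F-tied₀ i t₀ with Equivalence.to (T-∧ {tied i} {not (b i)}) t₀
  ... | a≡c , ¬bᵢ rewrite Equivalence.to T-not-≡ ¬bᵢ = trans (+-identityʳ (a i)) (tied⇒≡ a≡c)

  F-tied₁ : ∀ i → T (tied₁ i) → F i ≡ suc c
  F-tied₁ i t₁ with Equivalence.to (T-∧ {tied i} {b i}) t₁
  ... | a≡c , bᵢ rewrite T⇒≡ bᵢ = trans (+-comm (a i) 1) (cong suc (tied⇒≡ a≡c))

  F-above : ∀ i → T (above i) → suc c ≤ F i
  F-above i c<a = ≤-trans (<ᵇ⇒< c (a i) c<a) (m≤m+n (a i) (𝟙 (b i)))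

  valuesBelow valuesAbove ties : List ℕ
  valuesBelow = map F (indices below)
  valuesAbove = map F (indices above)
  ties        = replicate nTied₀ c ++ replicate nTied₁ (suc c)

  values-tied : map F (indices tied₀) ++ map F (indices tied₁) ≡ ties
  values-tied = cong₂ _++_
    (trans (map-filterᵇ-const tied₀ F-tied₀ (allFin M))
           (cong (λ n → replicate n c) (length-indices tied₀)))
    (trans (map-filterᵇ-const tied₁ F-tied₁ (allFin M))
           (cong (λ n → replicate n (suc c)) (length-indices tied₁)))

  values-↭ : map F (allFin M) ↭ valuesBelow ++ (ties ++ valuesAbove)
  values-↭ = begin
    map F (allFin M)
      ↭⟨ ↭.map⁺ F allFin-↭ ⟩
    map F (indices below ++ ((indices tied₀ ++ indices tied₁) ++ indices above))
      ≡⟨ trans (map-++ F (indices below) _)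
               (cong (valuesBelow ++_) (map-++ F (indices tied₀ ++ indices tied₁) _)) ⟩
    valuesBelow ++ (map F (indices tied₀ ++ indices tied₁) ++ valuesAbove)
      ≡⟨ cong (λ xs → valuesBelow ++ (xs ++ valuesAbove)) (trans (map-++ F (indices tied₀) _) values-tied) ⟩
    valuesBelow ++ (ties ++ valuesAbove) ∎
    where open PermutationReasoning

  sortℕ-values : sortℕ (map F (allFin M)) ≡ sortℕ valuesBelow ++ (ties ++ sortℕ valuesAbove)
  sortℕ-values = begin
    sortℕ (map F (allFin M))
      ≡⟨ sortℕ-↭ values-↭ ⟩
    sortℕ (valuesBelow ++ (ties ++ valuesAbove))
      ≡⟨ sortℕ-++ (separated-by c below≤c c≤ties++above) ⟩
    sortℕ valuesBelow ++ sortℕ (ties ++ valuesAbove)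
      ≡⟨ cong (sortℕ valuesBelow ++_) (sortℕ-++ ties≤above) ⟩
    sortℕ valuesBelow ++ (sortℕ ties ++ sortℕ valuesAbove)
      ≡⟨ cong (λ xs → sortℕ valuesBelow ++ (xs ++ sortℕ valuesAbove)) sortℕ-ties ⟩
    sortℕ valuesBelow ++ (ties ++ sortℕ valuesAbove) ∎
    where
    open ≡-Reasoning
    below≤c : All (_≤ c) valuesBelow
    below≤c = All-map-filterᵇ below F-below (allFin M)
    1+c≤above : All (suc c ≤_) valuesAbove
    1+c≤above = All-map-filterᵇ above F-above (allFin M)
    c≤ties++above : All (c ≤_) (ties ++ valuesAbove)
    c≤ties++above = All.++⁺ (All.++⁺ (All.replicate⁺ nTied₀ ≤-refl) (All.replicate⁺ nTied₁ (n≤1+n c)))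
                            (All.map <⇒≤ 1+c≤above)
    ties≤above : Separated ties valuesAbove
    ties≤above = separated-by (suc c)
      (All.++⁺ (All.replicate⁺ nTied₀ (n≤1+n c)) (All.replicate⁺ nTied₁ ≤-refl)) 1+c≤above
    sortℕ-ties : sortℕ ties ≡ ties
    sortℕ-ties = trans
      (sortℕ-++ (separated-by c (All.replicate⁺ nTied₀ ≤-refl) (All.replicate⁺ nTied₁ (n≤1+n c))))
      (cong₂ _++_ (sortℕ-replicate nTied₀ c) (sortℕ-replicate nTied₁ (suc c)))

  sum-valuesBelow : sum valuesBelow ≡ sumOver below a + count (λ i → below i ∧ b i)
  sum-valuesBelow = begin
    sum valuesBelow                           ≡⟨ sum-map-filter (T? ∘ below) F (allFin M) ⟩
    sumOver below F                           ≡⟨ sumOver-+ below a (𝟙 ∘ b) ⟩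
    sumOver below a + sumOver below (𝟙 ∘ b)   ≡⟨ cong (sumOver below a +_) (count-∧ below b) ⟨
    sumOver below a + count (λ i → below i ∧ b i) ∎
    where open ≡-Reasoning

  r≡|sortedBelow|+nTiedEarly : r ≡ length (sortℕ valuesBelow) + nTiedEarly
  r≡|sortedBelow|+nTiedEarly = begin
    r                                         ≡⟨ r≡nTiedEarly+nBelow ⟩
    nTiedEarly + nBelow                       ≡⟨ +-comm nTiedEarly nBelow ⟩
    nBelow + nTiedEarly                       ≡⟨ cong (_+ nTiedEarly) (length-indices below) ⟨
    length (indices below) + nTiedEarly       ≡⟨ cong (_+ nTiedEarly) (length-map F (indices below)) ⟨
    length valuesBelow + nTiedEarly           ≡⟨ cong (_+ nTiedEarly) (length-sortℕ valuesBelow) ⟨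
    length (sortℕ valuesBelow) + nTiedEarly   ∎
    where open ≡-Reasoning

  prefixSum-sortℕ : prefixSum r (sortℕ (map F (allFin M))) ≡
                    sumOver early a + count (λ i → below i ∧ b i) +
                    (count (λ i → (tied i ∧ early i) ∧ b i) ∸ count (λ i → tied₀ i ∧ not (early i)))
  prefixSum-sortℕ = begin
    prefixSum r (sortℕ (map F (allFin M)))
      ≡⟨ cong₂ prefixSum r≡|sortedBelow|+nTiedEarly sortℕ-values ⟩
    prefixSum (length (sortℕ valuesBelow) + nTiedEarly) (sortℕ valuesBelow ++ (ties ++ sortℕ valuesAbove))
      ≡⟨ prefixSum-++ (sortℕ valuesBelow) _ nTiedEarly ⟩
    sum (sortℕ valuesBelow) + prefixSum nTiedEarly (ties ++ sortℕ valuesAbove)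
      ≡⟨ cong₂ _+_ (trans (sum-sortℕ valuesBelow) sum-valuesBelow)
                   (prefixSum-ties c nTiedEarly nTied₀ nTied₁ _ nTiedEarly≤nTied₀+nTied₁) ⟩
    (sumOver below a + B) + (nTiedEarly * c + (nTiedEarly ∸ nTied₀))
      ≡⟨ cong (λ d → (sumOver below a + B) + (nTiedEarly * c + d)) nTiedEarly∸nTied₀ ⟩
    (sumOver below a + B) + (nTiedEarly * c + D)
      ≡⟨ interchange (sumOver below a) B (nTiedEarly * c) D ⟩
    (sumOver below a + nTiedEarly * c) + (B + D)
      ≡⟨ cong (_+ (B + D)) sumOver-early ⟨
    sumOver early a + (B + D)
      ≡⟨ +-assoc (sumOver early a) B D ⟨
    sumOver early a + B + D ∎
    where
    open ≡-Reasoning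
    B D : ℕ
    B = count (λ i → below i ∧ b i)
    D = count (λ i → (tied i ∧ early i) ∧ b i) ∸ count (λ i → tied₀ i ∧ not (early i))

∣p∣≡count : ∀ {n} (X : Subset n) → ∣ X ∣ ≡ count (lookup X)
∣p∣≡count []          = refl
∣p∣≡count (true ∷ X)  = trans (cong suc (∣p∣≡count X)) (sym (count-suc (lookup (true ∷ X))))
∣p∣≡count (false ∷ X) = trans (∣p∣≡count X) (sym (count-suc (lookup (false ∷ X))))

sumOver-∪ : ∀ {n} (X Y : Subset n) → Empty (X ∩ Y) → ∀ f →
            sumOver (lookup (X ∪ Y)) f ≡ sumOver (lookup X) f + sumOver (lookup Y) f
sumOver-∪ []      []      _        f = refl
sumOver-∪ (s ∷ X) (t ∷ Y) X∩Y≡∅ f = begin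
  sumOver (lookup ((s ∨ t) ∷ (X ∪ Y))) f
    ≡⟨ sumOver-suc (lookup ((s ∨ t) ∷ (X ∪ Y))) f ⟩
  at (s ∨ t) + sumOver (lookup (X ∪ Y)) (f ∘ fsuc)
    ≡⟨ cong₂ _+_ (at-∨ s t (λ s∧t → X∩Y≡∅ (fzero , s∧t)))
                 (sumOver-∪ X Y (λ (x , x∈X∩Y) → X∩Y≡∅ (fsuc x , there x∈X∩Y)) (f ∘ fsuc)) ⟩
  (at s + at t) + (sumOver (lookup X) (f ∘ fsuc) + sumOver (lookup Y) (f ∘ fsuc))
    ≡⟨ interchange (at s) (at t) (sumOver (lookup X) (f ∘ fsuc)) (sumOver (lookup Y) (f ∘ fsuc)) ⟩
  (at s + sumOver (lookup X) (f ∘ fsuc)) + (at t + sumOver (lookup Y) (f ∘ fsuc))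
    ≡⟨ cong₂ _+_ (sumOver-suc (lookup (s ∷ X)) f) (sumOver-suc (lookup (t ∷ Y)) f) ⟨
  sumOver (lookup (s ∷ X)) f + sumOver (lookup (t ∷ Y)) f ∎
  where
  open ≡-Reasoning
  at : Bool → ℕ
  at b = if b then f fzero else 0
  at-∨ : ∀ s t → ¬ (fzero ∈ ((s ∧ t) ∷ (X ∩ Y))) → at (s ∨ t) ≡ at s + at t
  at-∨ true  true  ¬both = ⊥-elim (¬both here)
  at-∨ true  false _     = sym (+-identityʳ (f fzero))
  at-∨ false _     _     = refl

sumOver-⁅⁆ : ∀ {n} (u : Fin n) (f : Fin n → ℕ) → sumOver (lookup ⁅ u ⁆) f ≡ f u
sumOver-⁅⁆ fzero    f = trans (sumOver-suc (lookup ⁅ fzero ⁆) f)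
  (trans (cong (f fzero +_) (sumOver-none _ (f ∘ fsuc) (λ i → lookup-replicate i false)))
         (+-identityʳ (f fzero)))
sumOver-⁅⁆ (fsuc u) f = trans (sumOver-suc (lookup ⁅ fsuc u ⁆) f) (sumOver-⁅⁆ u (f ∘ fsuc))

∣∩tabulate∣ : ∀ {n} (X : Subset n) (h : Fin n → Bool) →
              ∣ X ∩ tabulateᵛ h ∣ ≡ sumOver (lookup X) (𝟙 ∘ h)
∣∩tabulate∣ X h =
  trans (∣p∣≡count (X ∩ tabulateᵛ h)) (trans (sumOver-congˡ lookup-∩) (count-∧ (lookup X) h))
  where
  lookup-∩ : ∀ x → lookup (X ∩ tabulateᵛ h) x ≡ lookup X x ∧ h x
  lookup-∩ x = trans (lookup-zipWith _∧_ x X (tabulateᵛ h)) (cong (lookup X x ∧_) (lookup∘tabulate h x))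

module _ {n : ℕ} {X : Subset n} {x : Fin n} where

  T-lookup⇒∈ : T (lookup X x) → x ∈ X
  T-lookup⇒∈ = lookup⇒[]= x X ∘ T⇒≡

  ∈⇒T-lookup : x ∈ X → T (lookup X x)
  ∈⇒T-lookup x∈X = subst T (sym ([]=⇒lookup x∈X)) tt

  ∉⇒lookup-false : x ∉ X → lookup X x ≡ false
  ∉⇒lookup-false x∉X = ¬T⇒≡ (x∉X ∘ T-lookup⇒∈)

  lookup-false⇒∉ : lookup X x ≡ false → x ∉ X
  lookup-false⇒∉ X[x]≡false = subst T X[x]≡false ∘ ∈⇒T-lookup

lookup-─ : ∀ {n} (X Y : Subset n) x → lookup (X ─ Y) x ≡ lookup X x ∧ not (lookup Y x)
lookup-─ (s ∷ X) (true  ∷ Y) fzero    = sym (∧-zeroʳ s)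
lookup-─ (s ∷ X) (false ∷ Y) fzero    = sym (∧-identityʳ s)
lookup-─ (s ∷ X) (t     ∷ Y) (fsuc x) = lookup-─ X Y x

module _ {n M : ℕ} (v : Fin M → Fin n) (q : ℕ) where

  prefixSet⁻ : ∀ {x} → x ∈ prefixSet v q → ∃[ k ] T (toℕ k <ᵇ q) × v k ≡ x
  prefixSet⁻ {x} x∈ with Any.satisfied (any⁻ _ (allFin M) (subst T (lookup∘tabulate _ x) (∈⇒T-lookup x∈)))
  ... | k , k<q∧vk≡x with Equivalence.to (T-∧ {toℕ k <ᵇ q}) k<q∧vk≡x
  ...   | k<q , vk≡x = k , k<q , toWitness vk≡x

  prefixSet⁺ : ∀ {k} → T (toℕ k <ᵇ q) → v k ∈ prefixSet v q
  prefixSet⁺ {k} k<q = T-lookup⇒∈ (subst T (sym (lookup∘tabulate _ (v k)))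
    (any⁺ _ (Any.map (λ { refl → Equivalence.from T-∧ (k<q , fromWitness refl) }) (∈-allFin k))))

  lookup-prefixSet : Injective _≡_ _≡_ v → ∀ i → lookup (prefixSet v q) (v i) ≡ (toℕ i <ᵇ q)
  lookup-prefixSet v-injective i = Bool-ext
    (λ vi∈ → case prefixSet⁻ (T-lookup⇒∈ vi∈) of λ where
       (k , k<q , vk≡vi) → subst (λ k → T (toℕ k <ᵇ q)) (v-injective vk≡vi) k<q)
    (∈⇒T-lookup ∘ prefixSet⁺)

module Enumeration {n M : ℕ} {P : Fin n → Set} (P? : Decidable P) {v : Fin M → Fin n}
                   (v-injective : Injective _≡_ _≡_ v) (v-P : ∀ i → P (v i))
                   (v-onto : ∀ w → P w → ∃[ i ] v i ≡ w) where

  filter-↭-enumeration : filter P? (allFin n) ↭ map v (allFin M)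
  filter-↭-enumeration = ∼bag⇒↭ (unique∧set⇒bag
    (Unique.filter⁺ P? {allFin n} (Unique.allFin⁺ n))
    (Unique.map⁺ v-injective (Unique.allFin⁺ M))
    (mk⇔ to from))
    where
    to : ∀ {w} → w ∈ˡ filter P? (allFin n) → w ∈ˡ map v (allFin M)
    to {w} w∈ with v-onto w (proj₂ (∈-filter⁻ P? {xs = allFin n} w∈))
    ... | i , refl = ∈-map⁺ v (∈-allFin i)
    from : ∀ {w} → w ∈ˡ map v (allFin M) → w ∈ˡ filter P? (allFin n)
    from w∈ with ∈-map⁻ v w∈
    ... | i , _ , refl = ∈-filter⁺ P? (∈-allFin (v i)) (v-P i)

  sumOver-enumeration : ∀ h → sumOver (does ∘ P?) h ≡ ∑ (h ∘ v)
  sumOver-enumeration h = begin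
    sumOver (does ∘ P?) h                ≡⟨ sum-map-filter P? h (allFin n) ⟨
    sum (map h (filter P? (allFin n)))   ≡⟨ sum-↭ (↭.map⁺ h filter-↭-enumeration) ⟩
    sum (map h (map v (allFin M)))       ≡⟨ cong sum (map-∘ (allFin M)) ⟨
    ∑ (h ∘ v)                            ∎
    where open ≡-Reasoning

-- Non-neighbourhoods

nonAdjacent : ∀ {n} → Graph n → Fin n → Fin n → Bool
nonAdjacent g w x = not (adj g w x) ∧ not ⌊ x ≟ w ⌋

nonEdge< : ∀ {n} → Graph n → Fin n → Fin n → Bool
nonEdge< g x y = (toℕ x <ᵇ toℕ y) ∧ not (adj g x y)

module _ {n : ℕ} (g : Graph n) where

  nonAdjacent-≢ : ∀ {x w} → x ≢ w → nonAdjacent g w x ≡ not (adj g w x)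
  nonAdjacent-≢ {x} {w} x≢w with x ≟ w
  ... | yes x≡w = ⊥-elim (x≢w x≡w)
  ... | no _    = ∧-identityʳ _

  nonAdjacent-sym : ∀ {u w} → u ≢ w → nonAdjacent g w u ≡ not (adj g u w)
  nonAdjacent-sym {u} {w} u≢w = trans (nonAdjacent-≢ u≢w) (cong not (Graph.sym g w u))

  nonEdge<-irrefl : ∀ x → nonEdge< g x x ≡ false
  nonEdge<-irrefl x rewrite <ᵇ-false (n≮n (toℕ x)) = refl

  nonEdge<-either : ∀ {x u} → x ≢ u → 𝟙 (nonEdge< g x u) + 𝟙 (nonEdge< g u x) ≡ 𝟙 (nonAdjacent g u x)
  nonEdge<-either {x} {u} x≢u rewrite nonAdjacent-sym x≢u | Graph.sym g x u with <-cmp (toℕ x) (toℕ u)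
  ... | tri< x<u _ u≮x rewrite <ᵇ-true x<u | <ᵇ-false u≮x = +-identityʳ _
  ... | tri≈ _ x≡u _   = ⊥-elim (x≢u (toℕ-injective x≡u))
  ... | tri> x≮u _ u<x rewrite <ᵇ-false x≮u | <ᵇ-true u<x = refl

∣Nbar∣ : ∀ {n} (g : Graph n) X w → ∣ Nbar g X w ∣ ≡ sumOver (lookup X) (𝟙 ∘ nonAdjacent g w)
∣Nbar∣ g X w = ∣∩tabulate∣ X (nonAdjacent g w)

∣Nbar-∪∣ : ∀ {n} (g : Graph n) (X Y : Subset n) w → Empty (X ∩ Y) →
           ∣ Nbar g (X ∪ Y) w ∣ ≡ ∣ Nbar g X w ∣ + ∣ Nbar g Y w ∣
∣Nbar-∪∣ g X Y w X∩Y≡∅ = begin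
  ∣ Nbar g (X ∪ Y) w ∣                    ≡⟨ ∣Nbar∣ g (X ∪ Y) w ⟩
  sumOver (lookup (X ∪ Y)) (𝟙 ∘ nonAdjacent g w)
                                          ≡⟨ sumOver-∪ X Y X∩Y≡∅ _ ⟩
  sumOver (lookup X) (𝟙 ∘ nonAdjacent g w) + sumOver (lookup Y) (𝟙 ∘ nonAdjacent g w)
                                          ≡⟨ cong₂ _+_ (∣Nbar∣ g X w) (∣Nbar∣ g Y w) ⟨
  ∣ Nbar g X w ∣ + ∣ Nbar g Y w ∣         ∎
  where open ≡-Reasoning

module _ {n : ℕ} {S : Subset n} {u : Fin n} (u∉S : u ∉ S) where

  Empty[S∩⁅u⁆] : Empty (S ∩ ⁅ u ⁆)
  Empty[S∩⁅u⁆] (x , x∈S∩⁅u⁆) with x∈p∩q⁻ S ⁅ u ⁆ x∈S∩⁅u⁆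
  ... | x∈S , x∈⁅u⁆ = u∉S (subst (_∈ S) (x∈⁅y⁆⇒x≡y u x∈⁅u⁆) x∈S)

  sumOver-∪⁅⁆ : ∀ f → sumOver (lookup (S ∪ ⁅ u ⁆)) f ≡ sumOver (lookup S) f + f u
  sumOver-∪⁅⁆ f = trans (sumOver-∪ S ⁅ u ⁆ Empty[S∩⁅u⁆] f) (cong (sumOver (lookup S) f +_) (sumOver-⁅⁆ u f))

  ∣S∪⁅u⁆∣≡1+∣S∣ : ∣ S ∪ ⁅ u ⁆ ∣ ≡ suc ∣ S ∣
  ∣S∪⁅u⁆∣≡1+∣S∣ = begin
    ∣ S ∪ ⁅ u ⁆ ∣                   ≡⟨ ∣p∣≡count (S ∪ ⁅ u ⁆) ⟩
    count (lookup (S ∪ ⁅ u ⁆))      ≡⟨ sumOver-∪⁅⁆ (λ _ → 1) ⟩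
    count (lookup S) + 1            ≡⟨ +-comm _ 1 ⟩
    suc (count (lookup S))          ≡⟨ cong suc (∣p∣≡count S) ⟨
    suc ∣ S ∣                       ∎
    where open ≡-Reasoning

  ∣S∪⁅u⁆∩tabulate∣ : ∀ h → ∣ (S ∪ ⁅ u ⁆) ∩ tabulateᵛ h ∣ ≡ ∣ S ∩ tabulateᵛ h ∣ + 𝟙 (h u)
  ∣S∪⁅u⁆∩tabulate∣ h = begin
    ∣ (S ∪ ⁅ u ⁆) ∩ tabulateᵛ h ∣                   ≡⟨ ∣∩tabulate∣ (S ∪ ⁅ u ⁆) h ⟩
    sumOver (lookup (S ∪ ⁅ u ⁆)) (𝟙 ∘ h)           ≡⟨ sumOver-∪⁅⁆ (𝟙 ∘ h) ⟩
    sumOver (lookup S) (𝟙 ∘ h) + 𝟙 (h u)           ≡⟨ cong (_+ 𝟙 (h u)) (∣∩tabulate∣ S h) ⟨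
    ∣ S ∩ tabulateᵛ h ∣ + 𝟙 (h u)                   ∎
    where open ≡-Reasoning

  ∣Nbar-∪⁅u⁆∣ : ∀ (g : Graph n) {w} → u ≢ w →
                ∣ Nbar g (S ∪ ⁅ u ⁆) w ∣ ≡ ∣ Nbar g S w ∣ + 𝟙 (not (adj g u w))
  ∣Nbar-∪⁅u⁆∣ g {w} u≢w = trans (∣S∪⁅u⁆∩tabulate∣ (nonAdjacent g w))
    (cong (λ b → ∣ Nbar g S w ∣ + 𝟙 b) (nonAdjacent-sym g u≢w))

  Ebar-∪⁅u⁆ : ∀ (g : Graph n) → Ebar g (S ∪ ⁅ u ⁆) ≡ Ebar g S + ∣ Nbar g S u ∣
  Ebar-∪⁅u⁆ g = begin
    Ebar g R
      ≡⟨⟩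
    sumOver (lookup R) (λ x → ∣ R ∩ upper x ∣)
      ≡⟨ sumOver-∪⁅⁆ (λ x → ∣ R ∩ upper x ∣) ⟩
    sumOver (lookup S) (λ x → ∣ R ∩ upper x ∣) + ∣ R ∩ upper u ∣
      ≡⟨ cong₂ _+_ (∑-cong (λ x → cong (if lookup S x then_else 0) (∣S∪⁅u⁆∩tabulate∣ (nonEdge< g x))))
                   (∣S∪⁅u⁆∩tabulate∣ (nonEdge< g u)) ⟩
    ∑ₛ (λ x → ∣ S ∩ upper x ∣ + 𝟙 (nonEdge< g x u)) + (∣ S ∩ upper u ∣ + 𝟙 (nonEdge< g u u))
      ≡⟨ cong₂ _+_ (sumOver-+ (lookup S) (λ x → ∣ S ∩ upper x ∣) (λ x → 𝟙 (nonEdge< g x u)))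
                   (cong₂ _+_ (∣∩tabulate∣ S (nonEdge< g u)) (cong 𝟙 (nonEdge<-irrefl g u))) ⟩
    (Ebar g S + ∑ₛ (λ x → 𝟙 (nonEdge< g x u))) + (∑ₛ (λ x → 𝟙 (nonEdge< g u x)) + 0)
      ≡⟨ cong (Ebar g S + ∑ₛ (λ x → 𝟙 (nonEdge< g x u)) +_) (+-identityʳ _) ⟩
    (Ebar g S + ∑ₛ (λ x → 𝟙 (nonEdge< g x u))) + ∑ₛ (λ x → 𝟙 (nonEdge< g u x))
      ≡⟨ +-assoc (Ebar g S) _ _ ⟩
    Ebar g S + (∑ₛ (λ x → 𝟙 (nonEdge< g x u)) + ∑ₛ (λ x → 𝟙 (nonEdge< g u x)))
      ≡⟨ cong (Ebar g S +_) (sumOver-+ (lookup S) _ _) ⟨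
    Ebar g S + ∑ₛ (λ x → 𝟙 (nonEdge< g x u) + 𝟙 (nonEdge< g u x))
      ≡⟨ cong (Ebar g S +_) (sumOver-congʳ (lookup S) (λ x x∈S → nonEdge<-either g (∈S⇒≢u x∈S))) ⟩
    Ebar g S + ∑ₛ (𝟙 ∘ nonAdjacent g u)
      ≡⟨ cong (Ebar g S +_) (∣Nbar∣ g S u) ⟨
    Ebar g S + ∣ Nbar g S u ∣  ∎
    where
    open ≡-Reasoning
    R : Subset n
    R = S ∪ ⁅ u ⁆
    upper : Fin n → Subset n
    upper x = tabulateᵛ (nonEdge< g x)
    ∑ₛ : (Fin n → ℕ) → ℕ
    ∑ₛ = sumOver (lookup S)
    ∈S⇒≢u : ∀ {x} → T (lookup S x) → x ≢ u
    ∈S⇒≢u x∈S refl = u∉S (T-lookup⇒∈ x∈S)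

module Enumerated {n : ℕ} (g : Graph n) (S : Subset n) (u : Fin n) (u∉S : u ∉ S)
                  {M : ℕ} (v : Fin M → Fin n) (v-injective : Injective _≡_ _≡_ v)
                  (v∉R : ∀ i → v i ∉ (S ∪ ⁅ u ⁆)) (v-onto : ∀ w → w ∉ (S ∪ ⁅ u ⁆) → ∃[ i ] v i ≡ w) where

  R : Subset n
  R = S ∪ ⁅ u ⁆

  open Enumeration (λ w → lookup R w Bool.≟ false) v-injective
                   (∉⇒lookup-false ∘ v∉R) (λ w → v-onto w ∘ lookup-false⇒∉)

  a : Fin M → ℕ
  a i = ∣ Nbar g S (v i) ∣

  b : Fin M → Bool
  b i = not (adj g u (v i))

  u≢v : ∀ i → u ≢ v i
  u≢v i u≡vi = v∉R i (subst (_∈ R) u≡vi (x∈p∪q⁺ (inj₂ (x∈⁅x⁆ u))))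

  length-outside : length (outside R) ≡ M
  length-outside = trans (↭.↭-length filter-↭-enumeration)
                         (trans (length-map v (allFin M)) (length-tabulate (λ i → i)))

  sortedNonDegrees-enumerated : sortedNonDegrees g R ≡ sortℕ (map (λ i → a i + 𝟙 (b i)) (allFin M))
  sortedNonDegrees-enumerated = sortℕ-↭ (↭-trans (↭.map⁺ _ filter-↭-enumeration) (↭-reflexive
    (trans (sym (map-∘ (allFin M))) (map-cong (λ i → ∣Nbar-∪⁅u⁆∣ u∉S g (u≢v i)) (allFin M)))))

  module _ (X : Subset n) (X∩R≡∅ : ∀ {x} → x ∈ X → x ∉ R) where

    sumOver-pullback : ∀ f → sumOver (lookup X) f ≡ sumOver (lookup X ∘ v) (f ∘ v)
    sumOver-pullback f =
      trans (∑-cong outside-only) (sumOver-enumeration (λ x → if lookup X x then f x else 0))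
      where
      outside-only : ∀ x → (if lookup X x then f x else 0) ≡
                           (if does (lookup R x Bool.≟ false) then (if lookup X x then f x else 0) else 0)
      outside-only x with lookup X x in X[x]
      ... | true rewrite ∉⇒lookup-false (X∩R≡∅ (T-lookup⇒∈ (≡⇒T X[x]))) = refl
      ... | false with does (lookup R x Bool.≟ false)
      ...   | true  = refl
      ...   | false = refl

    ∣X∣-pullback : ∣ X ∣ ≡ count (lookup X ∘ v)
    ∣X∣-pullback = trans (∣p∣≡count X) (sumOver-pullback (λ _ → 1))

    ∣Nbar-pullback∣ : ∣ Nbar g X u ∣ ≡ count (λ i → lookup X (v i) ∧ b i)
    ∣Nbar-pullback∣ = begin
      ∣ Nbar g X u ∣                                     ≡⟨ ∣Nbar∣ g X u ⟩
      sumOver (lookup X) (𝟙 ∘ nonAdjacent g u)           ≡⟨ sumOver-pullback _ ⟩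
      sumOver (lookup X ∘ v) (𝟙 ∘ nonAdjacent g u ∘ v)
        ≡⟨ sumOver-congʳ (lookup X ∘ v) (λ i _ → cong 𝟙 (nonAdjacent-≢ g (u≢v i ∘ sym))) ⟩
      sumOver (lookup X ∘ v) (𝟙 ∘ b)                     ≡⟨ count-∧ (lookup X ∘ v) b ⟨
      count (λ i → lookup X (v i) ∧ b i)                 ∎
      where open ≡-Reasoning

    ∣N-pullback∣ : ∣ N g X u ∣ ≡ count (λ i → lookup X (v i) ∧ not (b i))
    ∣N-pullback∣ = begin
      ∣ N g X u ∣                                        ≡⟨ ∣∩tabulate∣ X (adj g u) ⟩
      sumOver (lookup X) (𝟙 ∘ adj g u)                   ≡⟨ sumOver-pullback _ ⟩
      sumOver (lookup X ∘ v) (𝟙 ∘ adj g u ∘ v)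
        ≡⟨ sumOver-congʳ (lookup X ∘ v) (λ i _ → cong 𝟙 (sym (not-involutive _))) ⟩
      sumOver (lookup X ∘ v) (𝟙 ∘ not ∘ b)               ≡⟨ count-∧ (lookup X ∘ v) (not ∘ b) ⟨
      count (λ i → lookup X (v i) ∧ not (b i))           ∎
      where open ≡-Reasoning

  lookup-sameKeySet : ∀ c i → lookup (sameKeySet g S R c) (v i) ≡ (a i ≡ᵇ c)
  lookup-sameKeySet c i =
    trans (lookup∘tabulate _ (v i)) (cong (λ β → not β ∧ (a i ≡ᵇ c)) (∉⇒lookup-false (v∉R i)))

  sameKeySet∩R≡∅ : ∀ c {x} → x ∈ sameKeySet g S R c → x ∉ R
  sameKeySet∩R≡∅ c {x} x∈C x∈R = subst T
    (trans (lookup∘tabulate _ x) (cong (λ β → not β ∧ (∣ Nbar g S x ∣ ≡ᵇ c)) ([]=⇒lookup x∈R)))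
    (∈⇒T-lookup x∈C)

  prefixSet∩R≡∅ : ∀ q {x} → x ∈ prefixSet v q → x ∉ R
  prefixSet∩R≡∅ q x∈P with prefixSet⁻ v q x∈P
  ... | k , _ , refl = v∉R k

  module Threshold (a-mono : ∀ i j → toℕ i ≤ toℕ j → a i ≤ a j) (ir : Fin M) where

    open TieBlock a a-mono ir b

    C C₁ C₂ D : Subset n
    C  = sameKeySet g S R ∣ Nbar g S (v ir) ∣
    C₁ = C ∩ prefixSet v r
    C₂ = C ─ C₁
    D  = prefixSet v (r ∸ ∣ C₁ ∣)

    C₁∩R≡∅ : ∀ {x} → x ∈ C₁ → x ∉ R
    C₁∩R≡∅ = sameKeySet∩R≡∅ c ∘ p∩q⊆p C (prefixSet v r)

    C₂∩R≡∅ : ∀ {x} → x ∈ C₂ → x ∉ R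
    C₂∩R≡∅ = sameKeySet∩R≡∅ c ∘ p─q⊆p C C₁

    lookup-C₁ : ∀ i → lookup C₁ (v i) ≡ tied i ∧ early i
    lookup-C₁ i = trans (lookup-zipWith _∧_ (v i) C (prefixSet v r))
                        (cong₂ _∧_ (lookup-sameKeySet c i) (lookup-prefixSet v r v-injective i))

    lookup-C₂ : ∀ i → lookup C₂ (v i) ≡ tied i ∧ not (tied i ∧ early i)
    lookup-C₂ i = trans (lookup-─ C C₁ (v i))
                        (cong₂ (λ x y → x ∧ not y) (lookup-sameKeySet c i) (lookup-C₁ i))

    ∣C₁∣≡nTiedEarly : ∣ C₁ ∣ ≡ nTiedEarly
    ∣C₁∣≡nTiedEarly = trans (∣X∣-pullback C₁ C₁∩R≡∅) (sumOver-congˡ lookup-C₁)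

    lookup-D : ∀ i → lookup D (v i) ≡ below i
    lookup-D i = trans (lookup-prefixSet v (r ∸ ∣ C₁ ∣) v-injective i)
                       (trans (cong (λ m → toℕ i <ᵇ r ∸ m) ∣C₁∣≡nTiedEarly) (sym (below≡prefix i)))

    S∩D≡∅ : Empty (S ∩ D)
    S∩D≡∅ (x , x∈S∩D) with x∈p∩q⁻ S D x∈S∩D
    ... | x∈S , x∈D = prefixSet∩R≡∅ (r ∸ ∣ C₁ ∣) x∈D (x∈p∪q⁺ (inj₁ x∈S))

    ∣Nbar-S∪D∣ : ∣ Nbar g (S ∪ D) u ∣ ≡ ∣ Nbar g S u ∣ + count (λ i → below i ∧ b i)
    ∣Nbar-S∪D∣ = trans (∣Nbar-∪∣ g S D u S∩D≡∅) (cong (∣ Nbar g S u ∣ +_)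
      (trans (∣Nbar-pullback∣ D (prefixSet∩R≡∅ (r ∸ ∣ C₁ ∣))) (sumOver-congˡ (λ i → cong (_∧ b i) (lookup-D i)))))

    ∣Nbar-C₁∣ : ∣ Nbar g C₁ u ∣ ≡ count (λ i → (tied i ∧ early i) ∧ b i)
    ∣Nbar-C₁∣ = trans (∣Nbar-pullback∣ C₁ C₁∩R≡∅) (sumOver-congˡ (λ i → cong (_∧ b i) (lookup-C₁ i)))

    ∣N-C₂∣ : ∣ N g C₂ u ∣ ≡ count (λ i → tied₀ i ∧ not (early i))
    ∣N-C₂∣ = trans (∣N-pullback∣ C₂ C₂∩R≡∅)
                   (sumOver-congˡ λ i → trans (cong (_∧ not (b i)) (lookup-C₂ i)) (tied∧late i))
      where
      tied∧late : ∀ i → (tied i ∧ not (tied i ∧ early i)) ∧ not (b i) ≡ tied₀ i ∧ not (early i)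
      tied∧late i with tied i
      ... | true  = ∧-comm (not (early i)) (not (b i))
      ... | false = refl

    cost-formula : Ebar g R + prefixSum r (sortedNonDegrees g R) ≡
                   Ebar g S + prefixSumV v (λ x → ∣ Nbar g S x ∣) r + ∣ Nbar g (S ∪ D) u ∣ +
                   (∣ Nbar g C₁ u ∣ ∸ ∣ N g C₂ u ∣)
    cost-formula = begin
      Ebar g R + prefixSum r (sortedNonDegrees g R)
        ≡⟨ cong₂ _+_ (Ebar-∪⁅u⁆ u∉S g)
                     (trans (cong (prefixSum r) sortedNonDegrees-enumerated) prefixSum-sortℕ) ⟩
      (Ebar g S + ∣ Nbar g S u ∣) + (sumOver early a + B + X∸Z)
        ≡⟨ +-assoc (Ebar g S + ∣ Nbar g S u ∣) (sumOver early a + B) X∸Z ⟨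
      (Ebar g S + ∣ Nbar g S u ∣) + (sumOver early a + B) + X∸Z
        ≡⟨ cong (_+ X∸Z) (interchange (Ebar g S) ∣ Nbar g S u ∣ (sumOver early a) B) ⟩
      Ebar g S + sumOver early a + (∣ Nbar g S u ∣ + B) + X∸Z
        ≡⟨ cong₂ (λ y z → Ebar g S + sumOver early a + y + z)
                 (sym ∣Nbar-S∪D∣) (sym (cong₂ _∸_ ∣Nbar-C₁∣ ∣N-C₂∣)) ⟩
      Ebar g S + prefixSumV v (λ x → ∣ Nbar g S x ∣) r + ∣ Nbar g (S ∪ D) u ∣ +
      (∣ Nbar g C₁ u ∣ ∸ ∣ N g C₂ u ∣) ∎
      where
      open ≡-Reasoning
      B X∸Z : ℕ
      B   = count (λ i → below i ∧ b i)
      X∸Z = count (λ i → (tied i ∧ early i) ∧ b i) ∸ count (λ i → tied₀ i ∧ not (early i))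

mainTheorem8 :
    ∀ {n : ℕ} (g : Graph n) (k : ℕ) → k ≥ 1 →
    (S : Subset n) (u : Fin n) → u ∉ S →
    (lb : ℕ) → ∣ S ∣ < lb → lb < n →
    -- ordering v_1,…,v_M of V(g) ∖ R, with v_i = v (i-1)
    (M : ℕ) (v : Fin M → Fin n) →
    Injective _≡_ _≡_ v →
    (∀ i → v i ∉ (S ∪ ⁅ u ⁆)) →
    (∀ w → w ∉ (S ∪ ⁅ u ⁆) → ∃[ i ] v i ≡ w) →
    (∀ i j → toℕ i ≤ toℕ j → ∣ Nbar g S (v i) ∣ ≤ ∣ Nbar g S (v j) ∣) →
    -- ir is the (0-based) position of v_r, r = lb - |S|
    (ir : Fin M) → toℕ ir + 1 ≡ lb ∸ ∣ S ∣ →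
    let R  = S ∪ ⁅ u ⁆
        r  = lb ∸ ∣ S ∣
        C  = sameKeySet g S R ∣ Nbar g S (v ir) ∣
        C₁ = C ∩ prefixSet v r
        C₂ = C ─ C₁
        D  = prefixSet v (r ∸ ∣ C₁ ∣)
    in (UB k g R ≤∞ lb) ⇔
       (k < Ebar g S + prefixSumV v (λ x → ∣ Nbar g S x ∣) r
              + ∣ Nbar g (S ∪ D) u ∣
              + (∣ Nbar g C₁ u ∣ ∸ ∣ N g C₂ u ∣))
mainTheorem8 g k _ S u u∉S lb ∣S∣<lb _ M v v-injective v∉R v-onto a-mono ir ir+1≡r
  rewrite sym (trans (+-comm 1 (toℕ ir)) ir+1≡r) =
  subst₂ (λ L κ → UB k g R ≤∞ L ⇔ k < κ) ∣R∣+ir≡lb cost-formula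
         (UB-≤∞-⇔ k g R (subst (toℕ ir <_) (sym length-outside) (toℕ<n ir)))
  where
  open Enumerated g S u u∉S v v-injective v∉R v-onto
  open Threshold a-mono ir
  1+ir≡r : suc (toℕ ir) ≡ lb ∸ ∣ S ∣
  1+ir≡r = trans (+-comm 1 (toℕ ir)) ir+1≡r
  ∣R∣+ir≡lb : ∣ R ∣ + toℕ ir ≡ lb
  ∣R∣+ir≡lb = begin
    ∣ R ∣ + toℕ ir            ≡⟨ cong (_+ toℕ ir) (∣S∪⁅u⁆∣≡1+∣S∣ u∉S) ⟩
    suc ∣ S ∣ + toℕ ir         ≡⟨ +-suc ∣ S ∣ (toℕ ir) ⟨
    ∣ S ∣ + suc (toℕ ir)       ≡⟨ cong (∣ S ∣ +_) 1+ir≡r ⟩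
    ∣ S ∣ + (lb ∸ ∣ S ∣)       ≡⟨ m+[n∸m]≡n (<⇒≤ ∣S∣<lb) ⟩
    lb                         ∎
    where open ≡-Reasoning
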